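{- For every positive integer $n$, $\operatorname{ord}_{s_{123,132}}(S_n)\ge 2\left\lfloor\frac{n-1}{2}\right\rfloor$.
   Context: $S_n$ is the set of permutations of $\{1,\dots,n\}$ in one-line notation. A sequence of distinct integers contains a pattern $\tau\in S_m$ if it has a subsequence in the same relative order as $\tau$; otherwise it avoids $\tau$. The map $s_{123,132}:S_n\to S_n$: read the entries of $\pi$ left to right using one stack (initially empty); at each step, if there is a remaining input entry $x$ and placing $x$ on top of the stack gives a stack whose contents read from top to bottom avoid both $123$ and $132$, push $x$ (pushing has priority); otherwise pop the top of the stack to the output. When the input is exhausted, pop the remaining stack entries from the top to the output. A permutation $\pi$ is periodic under $s_{123,132}$ if $s_{123,132}^k(\pi)=\pi$ for some positive integer $k$. For a set $P$ of permutations, $\operatorname{ord}_{s_{123,132}}(P)$ is the smallest nonnegative integer $k$ such that every element of $s_{123,132}^k(P)$ is periodic under $s_{123,132}$. -}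

module Defs where

open import Data.Nat using (ℕ; zero; suc; _<ᵇ_; _≤_)
open import Data.Bool using (Bool; true; false; _∧_; _∨_; if_then_else_; not)
open import Data.List using (List; []; _∷_; map; length; upTo; reverse; _++_; zip)
open import Data.Bool.ListAction using (all; any)
open import Data.Product using (_×_; _,_; ∃)
open import Data.List.Relation.Binary.Permutation.Propositional using (_↭_)
open import Relation.Binary.PropositionalEquality using (_≡_)

-- S_n : lists (one-line notation) that are rearrangements of 1,...,n
IsPerm : ℕ → List ℕ → Set
IsPerm n π = π ↭ map suc (upTo n)

_==ᵇ_ : Bool → Bool → Bool
true  ==ᵇ b = b
false ==ᵇ b = not b

sameOrder : List ℕ → List ℕ → Bool
sameOrder [] [] = true
sameOrder (a ∷ as) (b ∷ bs) =
  all (λ { (a' , b') → (a <ᵇ a') ==ᵇ (b <ᵇ b') }) (zip as bs) ∧ sameOrder as bs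
sameOrder _ _ = false

subseqs : ℕ → List ℕ → List (List ℕ)
subseqs zero    _        = [] ∷ []
subseqs (suc k) []       = []
subseqs (suc k) (x ∷ xs) = map (x ∷_) (subseqs k xs) ++ subseqs (suc k) xs

contains : List ℕ → List ℕ → Bool
contains τ σ = any (λ s → sameOrder s τ) (subseqs (length τ) σ)

avoids : List ℕ → List ℕ → Bool
avoids τ σ = not (contains τ σ)

-- stack contents listed from top to bottom may be pushed onto iff they avoid 123 and 132
okStack : List ℕ → Bool
okStack st = avoids (1 ∷ 2 ∷ 3 ∷ []) st ∧ avoids (1 ∷ 3 ∷ 2 ∷ []) st

-- handle next input entry x: pop until pushing x is allowed, then push.
-- stack is top-first; output accumulator is reversed.
-- (the case of an empty stack never fails okStack; we push there.)
feed : ℕ → List ℕ → List ℕ → List ℕ × List ℕ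
feed x st out with okStack (x ∷ st)
... | true = (x ∷ st , out)
feed x [] out | false = (x ∷ [] , out)
feed x (y ∷ st) out | false = feed x st (y ∷ out)

run : List ℕ → List ℕ → List ℕ → List ℕ
run [] st out = reverse out ++ st
run (x ∷ xs) st out with feed x st out
... | (st' , out') = run xs st' out'

s123-132 : List ℕ → List ℕ
s123-132 π = run π [] []

iterate : ℕ → (List ℕ → List ℕ) → List ℕ → List ℕ
iterate zero    f x = x
iterate (suc k) f x = f (iterate k f x)

Periodic : List ℕ → Set
Periodic π = ∃ λ k → 1 ≤ k × iterate k s123-132 π ≡ π

AllPeriodicAfter : ℕ → ℕ → Set
AllPeriodicAfter n k = ∀ π → IsPerm n π → Periodic (iterate k s123-132 π)

module Submission where

-- Call Zigzag r the permutations ending in y₀, r, y₁, r ∸ 1, y₂, …, 1, yᵣ with all other entries above r.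
-- Under s123-132 the first entry b stays at the bottom of the stack, each small entry k empties the
-- stack above b, and the result ends in y₁, r, y₂, …, yᵣ, 1, b: the word y₀ … yᵣ loses its first
-- letter and gains b. So Zigzag r is invariant, and a permutation outside Zigzag (suc r) whose image
-- lies in Zigzag (suc r) cannot be periodic.
-- Start from 2j+1, 2j, …, 1 followed by at least two larger entries. Each step shortens the descending
-- run by two and lengthens the zigzag tail by one, the old first entry becoming a new yᵢ; after j steps
-- the run is just j+1, which then travels through the word and after j+1 further steps sits in front of
-- the tail j, y₁, …, 1, yⱼ. That permutation is not in Zigzag (j+1) but its image is, so sᵏ(π) is not
-- periodic for any k ≤ 2j+1.

open import Defs
open import Data.Bool using (true; false; T)
open import Data.Bool.Properties using (T-≡; ∧-zeroʳ)
open import Data.List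
  using (List; []; _∷_; _++_; _ʳ++_; _∷ʳ_; [_]; reverse; length; map; upTo; downFrom; initLast; _∷ʳ′_)
open import Data.List.Properties
  using ( ++-assoc; ++-identityʳ; ʳ++-defn; ʳ++-ʳ++; ++-ʳ++; length-++; length-reverse; length-map
        ; length-downFrom; ∷-injective; ∷-injectiveʳ; reverse-upTo; reverse-map; map-cong)
open import Data.List.Relation.Unary.All using (All; []; _∷_)
import Data.List.Relation.Unary.All as All
open import Data.List.Relation.Unary.All.Properties using (++⁺; ∷ʳ⁺; ∷ʳ⁻)
open import Data.List.Relation.Binary.Permutation.Propositional using (_↭_; ↭-trans; ↭-reflexive)
open import Data.List.Relation.Binary.Permutation.Propositional.Properties using (↭-reverse; ++-comm)
open import Data.Nat using (ℕ; zero; suc; _+_; _*_; _∸_; _/_; _≤_; _<_; _<ᵇ_; z≤n; s≤s)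
open import Data.Nat.Properties
open import Data.Nat.DivMod using (m/n*n≤m)
open import Data.Nat.Tactic.RingSolver using (solve-∀)
open import Data.Product using (_×_; _,_; ∃; ∃₂; proj₁)
open import Data.Unit using (tt)
open import Function.Bundles using (module Equivalence)
open import Relation.Nullary using (¬_; contradiction)
open import Relation.Binary.PropositionalEquality hiding ([_])

<⇒<ᵇ≡true : ∀ {m n} → m < n → (m <ᵇ n) ≡ true
<⇒<ᵇ≡true m<n = Equivalence.to T-≡ (<⇒<ᵇ m<n)

>⇒<ᵇ≡false : ∀ {m n} → n < m → (m <ᵇ n) ≡ false
>⇒<ᵇ≡false {m} {n} n<m with m <ᵇ n in eq
... | false = refl
... | true  = contradiction (<ᵇ⇒< m n (subst T (sym eq) tt)) (<⇒≯ n<m)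

okStack-top-above-second : ∀ x y z → y < x → okStack (x ∷ y ∷ z ∷ []) ≡ true
okStack-top-above-second x y z y<x rewrite >⇒<ᵇ≡false {x} {y} y<x = refl

okStack-top-below-two : ∀ x y z rest → x < y → x < z → okStack (x ∷ y ∷ z ∷ rest) ≡ false
okStack-top-below-two x y z rest x<y x<z rewrite <⇒<ᵇ≡true x<y | <⇒<ᵇ≡true x<z with y <ᵇ z
... | true  = refl
... | false = ∧-zeroʳ _

Config : Set
Config = List ℕ × List ℕ

runFrom : List ℕ → Config → List ℕ
runFrom xs (st , out) = run xs st out

Reads : List ℕ → Config → Config → Set
Reads xs c c′ = ∀ zs → runFrom (xs ++ zs) c ≡ runFrom zs c′

run-∷ : ∀ x xs st out → run (x ∷ xs) st out ≡ runFrom xs (feed x st out)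
run-∷ x xs st out with feed x st out
... | _ = refl

run-feed : ∀ x xs st out {st′ out′} → feed x st out ≡ (st′ , out′) →
  run (x ∷ xs) st out ≡ run xs st′ out′
run-feed x xs st out eq = trans (run-∷ x xs st out) (cong (runFrom xs) eq)

reads-∷ : ∀ x xs st out {c c′} → feed x st out ≡ c → Reads xs c c′ → Reads (x ∷ xs) (st , out) c′
reads-∷ x xs st out eq r zs =
  trans (run-∷ x (xs ++ zs) st out) (trans (cong (runFrom (xs ++ zs)) eq) (r zs))

reads-++ : ∀ {xs ys c c′ c″} → Reads xs c c′ → Reads ys c′ c″ → Reads (xs ++ ys) c c″
reads-++ {xs} {ys} {c} r r′ zs =
  trans (cong (λ l → runFrom l c) (++-assoc xs ys zs)) (trans (r (ys ++ zs)) (r′ zs))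

feed-push : ∀ x st out → okStack (x ∷ st) ≡ true → feed x st out ≡ (x ∷ st , out)
feed-push x st out ok rewrite ok = refl

feed-pop : ∀ x y st out → okStack (x ∷ y ∷ st) ≡ false → feed x (y ∷ st) out ≡ feed x st (y ∷ out)
feed-pop x y st out nok rewrite nok = refl

feed-pops-to-bottom : ∀ x b st out → All (x <_) st → x < b →
  feed x (st ++ [ b ]) out ≡ (x ∷ b ∷ [] , st ʳ++ out)
feed-pops-to-bottom x b [] out [] x<b = refl
feed-pops-to-bottom x b (y ∷ []) out (x<y ∷ []) x<b =
  feed-pop x y [ b ] out (okStack-top-below-two x y b [] x<y x<b)
feed-pops-to-bottom x b (y ∷ z ∷ st) out (x<y ∷ x<z ∷ x<st) x<b =
  trans (feed-pop x y (z ∷ st ++ [ b ]) out (okStack-top-below-two x y z (st ++ [ b ]) x<y x<z))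
        (feed-pops-to-bottom x b (z ∷ st) (y ∷ out) (x<z ∷ x<st) x<b)

ʳ++⁺ : ∀ {A : Set} {P : A → Set} {xs ys} → All P xs → All P ys → All P (xs ʳ++ ys)
ʳ++⁺ []         pys = pys
ʳ++⁺ (px ∷ pxs) pys = ʳ++⁺ pxs (px ∷ pys)

ʳ++-++ : ∀ {A : Set} (xs : List A) {ys zs} → (xs ʳ++ ys) ++ zs ≡ xs ʳ++ (ys ++ zs)
ʳ++-++ xs {ys} {zs} = begin
  (xs ʳ++ ys) ++ zs       ≡⟨ cong (_++ zs) (ʳ++-defn xs) ⟩
  (reverse xs ++ ys) ++ zs ≡⟨ ++-assoc (reverse xs) ys zs ⟩
  reverse xs ++ ys ++ zs   ≡⟨ ʳ++-defn xs ⟨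
  xs ʳ++ (ys ++ zs)        ∎
  where open ≡-Reasoning

length-∷ʳ : ∀ {A : Set} (xs : List A) x → length (xs ∷ʳ x) ≡ suc (length xs)
length-∷ʳ xs x = trans (length-++ xs) (+-comm (length xs) 1)

same-length-suffix : ∀ {A : Set} (xs ys : List A) {us vs} →
  xs ++ us ≡ ys ++ vs → length us ≡ length vs → us ≡ vs
same-length-suffix []       []       eq _ = eq
same-length-suffix []       (y ∷ ys) {vs = vs} eq len =
  contradiction (trans (sym len) (trans (cong length eq) (cong suc (length-++ ys)))) (m≢1+n+m (length vs))
same-length-suffix (x ∷ xs) []       {us = us} eq len =
  contradiction (trans len (trans (cong length (sym eq)) (cong suc (length-++ xs)))) (m≢1+n+m (length us))
same-length-suffix (x ∷ xs) (y ∷ ys) eq len = same-length-suffix xs ys (∷-injectiveʳ eq) len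

module AboveBottom {P : ℕ → Set} (bottom : List ℕ)
                   (pushable : ∀ {x} → P x → okStack (x ∷ bottom) ≡ true) where

  feed-above : ∀ {x} st out → P x → All P st →
    ∃₂ λ st′ o → All P st′ × All P o × feed x (st ++ bottom) out ≡ (st′ ++ bottom , o ++ out)
  feed-above {x} [] out px [] = x ∷ [] , [] , px ∷ [] , [] , feed-push x bottom out (pushable px)
  feed-above {x} (y ∷ st) out px (py ∷ pst) with okStack (x ∷ y ∷ st ++ bottom) in ok
  ... | true  = x ∷ y ∷ st , [] , px ∷ py ∷ pst , [] , refl
  ... | false with feed-above st (y ∷ out) px pst
  ...   | st′ , o , pst′ , po , eq =
    st′ , o ∷ʳ y , pst′ , ∷ʳ⁺ po py ,
    trans eq (cong (st′ ++ bottom ,_) (sym (++-assoc o [ y ] out)))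

  reads-above : ∀ xs st out → All P xs → All P st →
    ∃₂ λ st′ o → All P st′ × All P o × Reads xs (st ++ bottom , out) (st′ ++ bottom , o ++ out)
  reads-above [] st out [] pst = st , [] , pst , [] , λ _ → refl
  reads-above (x ∷ xs) st out (px ∷ pxs) pst with feed-above st out px pst
  ... | st₁ , o₁ , pst₁ , po₁ , eq₁ with reads-above xs st₁ (o₁ ++ out) pxs pst₁
  ... | st₂ , o₂ , pst₂ , po₂ , reads =
    st₂ , o₂ ++ o₁ , pst₂ , ++⁺ po₂ po₁ ,
    reads-∷ x xs (st ++ bottom) out eq₁
      (subst (Reads xs _) (cong (st₂ ++ bottom ,_) (sym (++-assoc o₂ o₁ out))) reads)

reads-first-at-bottom : ∀ {P : ℕ → Set} b α → All P α →
  ∃₂ λ st o → All P st × All P o × Reads (b ∷ α) ([] , []) (st ++ [ b ] , o)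
reads-first-at-bottom {P} b α pα with AboveBottom.reads-above {P} [ b ] (λ _ → refl) α [] [] pα []
... | st , o , pst , po , reads =
  st , o , pst , po ,
  reads-∷ b α [] [] refl (subst (Reads α ([ b ] , [])) (cong (st ++ [ b ] ,_) (++-identityʳ o)) reads)

size : Config → ℕ
size (st , out) = length st + length out

size-feed : ∀ x st out → size (feed x st out) ≡ suc (size (st , out))
size-feed x st out with okStack (x ∷ st)
... | true = refl
size-feed x []       out | false = refl
size-feed x (y ∷ st) out | false =
  trans (size-feed x st (y ∷ out)) (cong suc (+-suc (length st) (length out)))

length-runFrom : ∀ xs c → length (runFrom xs c) ≡ length xs + size c
length-runFrom [] (st , out) = begin
  length (reverse out ++ st)        ≡⟨ length-++ (reverse out) ⟩
  length (reverse out) + length st  ≡⟨ cong (_+ length st) (length-reverse out) ⟩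
  length out + length st            ≡⟨ +-comm (length out) (length st) ⟩
  length st + length out            ∎
  where open ≡-Reasoning
length-runFrom (x ∷ xs) (st , out) = begin
  length (run (x ∷ xs) st out)             ≡⟨ cong length (run-∷ x xs st out) ⟩
  length (runFrom xs (feed x st out))      ≡⟨ length-runFrom xs (feed x st out) ⟩
  length xs + size (feed x st out)         ≡⟨ cong (length xs +_) (size-feed x st out) ⟩
  length xs + suc (size (st , out))        ≡⟨ +-suc (length xs) _ ⟩
  suc (length xs + size (st , out))        ∎
  where open ≡-Reasoning

length-s123-132 : ∀ σ → length (s123-132 σ) ≡ length σ
length-s123-132 σ = trans (length-runFrom σ ([] , [])) (+-identityʳ (length σ))

iterate-preserves : ∀ {P : List ℕ → Set} {f} → (∀ x → P x → P (f x)) →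
  ∀ m {x} → P x → P (iterate m f x)
iterate-preserves         pf zero    px = px
iterate-preserves {f = f} pf (suc m) {x} px = pf (iterate m f x) (iterate-preserves pf m px)

iterate-suc′ : ∀ m (f : List ℕ → List ℕ) x → iterate m f (f x) ≡ iterate (suc m) f x
iterate-suc′ zero    f x = refl
iterate-suc′ (suc m) f x = cong f (iterate-suc′ m f x)

iterate-+ : ∀ a b (f : List ℕ → List ℕ) x → iterate a f (iterate b f x) ≡ iterate (a + b) f x
iterate-+ zero    b f x = refl
iterate-+ (suc a) b f x = cong f (iterate-+ a b f x)

length-iterate-s123-132 : ∀ m σ → length (iterate m s123-132 σ) ≡ length σ
length-iterate-s123-132 zero    σ = refl
length-iterate-s123-132 (suc m) σ =
  trans (length-s123-132 (iterate m s123-132 σ)) (length-iterate-s123-132 m σ)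

periodic-s123-132 : ∀ {σ} → Periodic σ → Periodic (s123-132 σ)
periodic-s123-132 {σ} (m , 1≤m , returns) =
  m , 1≤m , trans (iterate-suc′ m s123-132 σ) (cong s123-132 returns)

periodic-later : ∀ {k N} σ → k ≤ N → Periodic (iterate k s123-132 σ) → Periodic (iterate N s123-132 σ)
periodic-later {k} {N} σ k≤N per =
  subst Periodic (trans (iterate-+ (N ∸ k) k s123-132 σ) (cong (λ n → iterate n s123-132 σ) (m∸n+n≡m k≤N)))
    (iterate-preserves {Periodic} (λ _ → periodic-s123-132) (N ∸ k) per)

-- weave r [a₁, …, aᵣ] = r, a₁, r ∸ 1, a₂, …, 1, aᵣ
weave : ℕ → List ℕ → List ℕ
zig   : ℕ → List ℕ → List ℕ

weave zero    _  = []
weave (suc r) ys = suc r ∷ zig r ys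

zig r []       = []
zig r (y ∷ ys) = y ∷ weave r ys

length-weave : ∀ r ys → length ys ≡ r → length (weave r ys) ≡ r + r
length-weave zero    []       _   = refl
length-weave (suc r) (y ∷ ys) |ys| =
  cong suc (trans (cong suc (length-weave r ys (suc-injective |ys|))) (sym (+-suc r r)))

-- Reading weave r ys empties the stack down to its bottom entry b, which then ends the zigzag.
drain : ∀ r st b ys out → All (r <_) st → r < b → All (r <_) ys → length ys ≡ r →
  run (weave r ys) (st ++ [ b ]) out ≡ out ʳ++ (st ++ zig r (ys ∷ʳ b))
drain zero    st b []       out _    _   _            _    = sym (ʳ++-defn out)
drain (suc r) st b (y ∷ ys) out r<st r<b (r<y ∷ r<ys) |ys| = begin
  run (suc r ∷ y ∷ weave r ys) (st ++ [ b ]) out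
    ≡⟨ run-feed (suc r) (y ∷ weave r ys) (st ++ [ b ]) out
         (feed-pops-to-bottom (suc r) b st out r<st r<b) ⟩
  run (y ∷ weave r ys) (suc r ∷ b ∷ []) (st ʳ++ out)
    ≡⟨ run-feed y (weave r ys) (suc r ∷ b ∷ []) (st ʳ++ out)
         (feed-push y (suc r ∷ b ∷ []) (st ʳ++ out) (okStack-top-above-second y (suc r) b r<y)) ⟩
  run (weave r ys) ((y ∷ suc r ∷ []) ++ [ b ]) (st ʳ++ out)
    ≡⟨ drain r (y ∷ suc r ∷ []) b ys (st ʳ++ out) (pred< r<y ∷ n<1+n r ∷ []) (pred< r<b)
             (All.map pred< r<ys) (suc-injective |ys|) ⟩
  (st ʳ++ out) ʳ++ (y ∷ suc r ∷ zig r (ys ∷ʳ b))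
    ≡⟨ ʳ++-ʳ++ st ⟩
  out ʳ++ (st ++ zig (suc r) ((y ∷ ys) ∷ʳ b))
    ∎
  where
  open ≡-Reasoning
  pred< : ∀ {x} → suc r < x → r < x
  pred< = <-trans (n<1+n r)

rotate : ∀ {m} r b α ws → r ≤ m → All (m <_) α → r < b → All (r <_) ws → length ws ≡ r →
  ∃ λ β → All (m <_) β × s123-132 ((b ∷ α) ++ weave r ws) ≡ β ++ zig r (ws ∷ʳ b)
rotate {m} r b α ws r≤m m<α r<b r<ws |ws| with reads-first-at-bottom {m <_} b α m<α
... | st , o , m<st , m<o , reads = o ʳ++ st , ʳ++⁺ m<o m<st , (begin
  run ((b ∷ α) ++ weave r ws) [] []
    ≡⟨ reads (weave r ws) ⟩
  run (weave r ws) (st ++ [ b ]) o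
    ≡⟨ drain r st b ws o (All.map (≤-<-trans r≤m) m<st) r<b r<ws |ws| ⟩
  o ʳ++ (st ++ zig r (ws ∷ʳ b))
    ≡⟨ ʳ++-++ o ⟨
  (o ʳ++ st) ++ zig r (ws ∷ʳ b)
    ∎)
  where open ≡-Reasoning

rotate-zig : ∀ {m} r α y ws → r ≤ m → All (m <_) α → m < y → All (r <_) ws → length ws ≡ r →
  ∃₂ λ β b → All (m <_) β × m < b × s123-132 (α ++ zig r (y ∷ ws)) ≡ β ++ zig r (ws ∷ʳ b)
rotate-zig r [] y ws r≤m [] m<y r<ws |ws|
  with rotate r y [] ws r≤m [] (≤-<-trans r≤m m<y) r<ws |ws|
... | β , m<β , eq = β , y , m<β , m<y , eq
rotate-zig r (a ∷ α) y ws r≤m (m<a ∷ m<α) m<y r<ws |ws|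
  with rotate r a (α ∷ʳ y) ws r≤m (∷ʳ⁺ m<α m<y) (≤-<-trans r≤m m<a) r<ws |ws|
... | β , m<β , eq =
  β , a , m<β , m<a , trans (cong s123-132 (sym (++-assoc (a ∷ α) [ y ] (weave r ws)))) eq

Zigzag : ℕ → List ℕ → Set
Zigzag r σ = ∃₂ λ α ys → All (r <_) α × All (r <_) ys × length ys ≡ suc r × σ ≡ α ++ zig r ys

zigzag-s123-132 : ∀ {r σ} → Zigzag r σ → Zigzag r (s123-132 σ)
zigzag-s123-132 {r} (α , y ∷ ws , r<α , r<y ∷ r<ws , |ys| , refl)
  with rotate-zig r α y ws ≤-refl r<α r<y r<ws (suc-injective |ys|)
... | β , b , r<β , r<b , eq = β , ws ∷ʳ b , r<β , ∷ʳ⁺ r<ws r<b , trans (length-∷ʳ ws b) |ys| , eq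

-- A Zigzag r whose first zigzag entry is suc r; in a Zigzag (suc r) that position holds an entry above suc r.
Marked : ℕ → List ℕ → Set
Marked r q = ∃₂ λ γ zs → All (suc r <_) γ × All (suc r <_) zs × length zs ≡ r ×
  q ≡ γ ++ zig r (suc r ∷ zs)

marked-not-zigzag : ∀ {r q} → Marked r q → ¬ Zigzag (suc r) q
marked-not-zigzag {r} (γ , zs , _ , _ , |zs| , refl) (α , y ∷ y₁ ∷ ws , _ , _ ∷ r<y₁ ∷ _ , |ys| , eq) =
  <-irrefl (proj₁ (∷-injective tails)) r<y₁
  where
  tails : suc r ∷ weave r zs ≡ y₁ ∷ weave r ws
  tails = same-length-suffix γ (α ++ y ∷ suc r ∷ []) (trans eq (sym (++-assoc α (y ∷ suc r ∷ []) _)))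
            (cong suc (trans (length-weave r zs |zs|) (sym (length-weave r ws (suc-injective (suc-injective |ys|))))))

zigzag-after-marker : ∀ r β ws → All (suc r <_) β → All (suc r <_) ws → length ws ≡ suc r →
  suc (suc (r + r)) < length (β ++ suc r ∷ zig r ws) → Zigzag (suc r) (β ++ suc r ∷ zig r ws)
zigzag-after-marker r β [] r<β r<ws () long
zigzag-after-marker r β (w ∷ ws) r<β r<ws |ws| long with initLast β
... | [] = contradiction long (<-irrefl (cong (λ n → suc (suc n)) (sym (length-weave r ws (suc-injective |ws|)))))
... | α ∷ʳ′ y with ∷ʳ⁻ r<β
...   | r<α , r<y = α , y ∷ w ∷ ws , r<α , r<y ∷ r<ws , cong suc |ws| , ++-assoc α [ y ] _

marked-s123-132 : ∀ {r q} → Marked r q → suc (suc (r + r)) < length q → Zigzag (suc r) (s123-132 q)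
marked-s123-132 {r} ([] , zs , _ , _ , |zs| , refl) long =
  contradiction (<-trans (n<1+n _) long) (<-irrefl (cong suc (sym (length-weave r zs |zs|))))
marked-s123-132 {r} (g ∷ γ , zs , r<g ∷ r<γ , r<zs , |zs| , refl) long
  with reads-first-at-bottom {suc r <_} g γ r<γ
... | st , o , r<st , r<o , reads =
  subst (Zigzag (suc r)) (sym eq)
    (zigzag-after-marker r ((st ʳ++ o) ʳ++ []) (zs ∷ʳ g) (ʳ++⁺ (ʳ++⁺ r<st r<o) []) (∷ʳ⁺ r<zs r<g)
      (trans (length-∷ʳ zs g) (cong suc |zs|))
      (subst (suc (suc (r + r)) <_) (trans (sym (length-s123-132 q)) (cong length eq)) long))
  where
  open ≡-Reasoning
  q = (g ∷ γ) ++ zig r (suc r ∷ zs)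
  eq : s123-132 q ≡ ((st ʳ++ o) ʳ++ []) ++ suc r ∷ zig r (zs ∷ʳ g)
  eq = begin
    run ((g ∷ γ) ++ suc r ∷ weave r zs) [] []
      ≡⟨ reads (suc r ∷ weave r zs) ⟩
    run (suc r ∷ weave r zs) (st ++ [ g ]) o
      ≡⟨ run-feed (suc r) (weave r zs) (st ++ [ g ]) o
           (feed-pops-to-bottom (suc r) g st o r<st r<g) ⟩
    run (weave r zs) ([ suc r ] ++ [ g ]) (st ʳ++ o)
      ≡⟨ drain r [ suc r ] g zs (st ʳ++ o) (n<1+n r ∷ []) (<-trans (n<1+n r) r<g)
           (All.map (<-trans (n<1+n r)) r<zs) |zs| ⟩
    (st ʳ++ o) ʳ++ (suc r ∷ zig r (zs ∷ʳ g))
      ≡⟨ ʳ++-++ (st ʳ++ o) ⟨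
    ((st ʳ++ o) ʳ++ []) ++ suc r ∷ zig r (zs ∷ʳ g)
      ∎

marked-not-periodic : ∀ {r q} → Marked r q → suc (suc (r + r)) < length q → ¬ Periodic q
marked-not-periodic {r} {q} marked long (suc m , _ , returns) =
  marked-not-zigzag marked
    (subst (Zigzag (suc r)) (trans (iterate-suc′ m s123-132 q) returns)
      (iterate-preserves {Zigzag (suc r)} (λ _ → zigzag-s123-132) m (marked-s123-132 marked long)))

marker-reaches-front : ∀ r ys₁ ys₂ α → All (suc r <_) α → All (suc r <_) ys₁ → All (suc r <_) ys₂ →
  length (ys₁ ++ suc r ∷ ys₂) ≡ suc r →
  Marked r (iterate (length ys₁) s123-132 (α ++ zig r (ys₁ ++ suc r ∷ ys₂)))
marker-reaches-front r [] ys₂ α r<α [] r<ys₂ len = α , ys₂ , r<α , r<ys₂ , suc-injective len , refl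
marker-reaches-front r (y ∷ ys₁) ys₂ α r<α (r<y ∷ r<ys₁) r<ys₂ len
  with rotate-zig r α y (ys₁ ++ suc r ∷ ys₂) (n≤1+n r) r<α r<y
         (++⁺ (All.map (<-trans (n<1+n r)) r<ys₁) (n<1+n r ∷ All.map (<-trans (n<1+n r)) r<ys₂))
         (suc-injective len)
... | β , b , r<β , r<b , eq =
  subst (Marked r) shift
    (marker-reaches-front r ys₁ (ys₂ ∷ʳ b) β r<β r<ys₁ (∷ʳ⁺ r<ys₂ r<b)
      (trans (cong length (sym reassoc)) (trans (length-∷ʳ (ys₁ ++ suc r ∷ ys₂) b) len)))
  where
  open ≡-Reasoning
  k = length ys₁
  reassoc : (ys₁ ++ suc r ∷ ys₂) ∷ʳ b ≡ ys₁ ++ suc r ∷ ys₂ ∷ʳ b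
  reassoc = ++-assoc ys₁ (suc r ∷ ys₂) [ b ]
  shift : iterate k s123-132 (β ++ zig r (ys₁ ++ suc r ∷ ys₂ ∷ʳ b))
        ≡ iterate (suc k) s123-132 (α ++ zig r (y ∷ ys₁ ++ suc r ∷ ys₂))
  shift = begin
    iterate k s123-132 (β ++ zig r (ys₁ ++ suc r ∷ ys₂ ∷ʳ b))
      ≡⟨ cong (λ ws → iterate k s123-132 (β ++ zig r ws)) reassoc ⟨
    iterate k s123-132 (β ++ zig r ((ys₁ ++ suc r ∷ ys₂) ∷ʳ b))
      ≡⟨ cong (iterate k s123-132) eq ⟨
    iterate k s123-132 (s123-132 (α ++ zig r (y ∷ ys₁ ++ suc r ∷ ys₂)))
      ≡⟨ iterate-suc′ k s123-132 _ ⟩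
    iterate (suc k) s123-132 (α ++ zig r (y ∷ ys₁ ++ suc r ∷ ys₂))
      ∎

descending : ℕ → ℕ → List ℕ
descending t c = map (λ i → suc (i + t)) (downFrom c)

length-descending : ∀ t c → length (descending t c) ≡ c
length-descending t c = trans (length-map _ (downFrom c)) (length-downFrom c)

descending-above : ∀ t c → All (t <_) (descending t c)
descending-above t zero    = []
descending-above t (suc c) = s≤s (m≤n+m t c) ∷ descending-above t c

descending-+ : ∀ t m c → descending t (m + c) ≡ descending (c + t) m ++ descending t c
descending-+ t zero    c = refl
descending-+ t (suc m) c = cong₂ _∷_ (cong suc (+-assoc m c t)) (descending-+ t m c)

descending-↭ : ∀ n → descending 0 n ↭ map suc (upTo n)
descending-↭ n = ↭-trans (↭-reflexive ordered) (↭-reverse (map suc (upTo n)))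
  where
  ordered : descending 0 n ≡ reverse (map suc (upTo n))
  ordered = begin
    map (λ i → suc (i + 0)) (downFrom n) ≡⟨ map-cong (λ i → cong suc (+-identityʳ i)) (downFrom n) ⟩
    map suc (downFrom n)                 ≡⟨ cong (map suc) (reverse-upTo n) ⟨
    map suc (reverse (upTo n))           ≡⟨ reverse-map suc (upTo n) ⟩
    reverse (map suc (upTo n))           ∎
    where open ≡-Reasoning

-- Each entry of the run pops its predecessor, so b stays at the bottom.
reads-descending : ∀ m t b out → m + t < b →
  Reads (descending t m) (suc (m + t) ∷ b ∷ [] , out) (suc t ∷ b ∷ [] , descending (suc t) m ʳ++ out)
reads-descending zero    t b out _     _ = refl
reads-descending (suc m) t b out m+t<b =
  subst (λ y → Reads (descending t (suc m)) (suc (suc m + t) ∷ b ∷ [] , out)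
                     (suc t ∷ b ∷ [] , descending (suc t) m ʳ++ y ∷ out))
        (cong suc (sym (+-suc m t)))
    (reads-∷ x (descending t m) (suc (suc m + t) ∷ b ∷ []) out
      (feed-pop x (suc x) [ b ] out (okStack-top-below-two x (suc x) b [] (n<1+n x) m+t<b))
      (reads-descending m t b (suc x ∷ out) (<-trans (n<1+n (m + t)) m+t<b)))
  where x = suc (m + t)

reads-descending-from-empty : ∀ m t →
  Reads (descending t (2 + m)) ([] , []) (suc t ∷ suc (suc m + t) ∷ [] , descending (suc t) m ʳ++ [])
reads-descending-from-empty m t =
  reads-++ {xs = suc (suc m + t) ∷ suc (m + t) ∷ []} {descending t m} {[] , []}
    {suc (m + t) ∷ suc (suc m + t) ∷ [] , []} (λ _ → refl)
    (reads-descending m t (suc (suc m + t)) [] (<-trans (n<1+n (m + t)) (n<1+n (suc (m + t)))))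

DescentShape : ℕ → ℕ → ℕ → List ℕ → Set
DescentShape M t L σ = ∃₂ λ B as → All (M <_) B × All (L + t <_) as × length as ≡ t ×
  σ ≡ (descending t L ++ B) ++ weave t as

-- The bottom t + L + 2 of the run becomes the new partner, and t + 1 joins the zigzag.
descent-step : ∀ {M t L σ} → t < M → DescentShape M t (2 + L) σ → DescentShape M (suc t) L (s123-132 σ)
descent-step {M} {t} {L} t<M (B , as , M<B , <as , |as| , refl)
  with AboveBottom.reads-above {M <_} (suc t ∷ suc (suc L + t) ∷ [])
         (λ M<x → okStack-top-above-second _ (suc t) (suc (suc L + t)) (≤-<-trans t<M M<x))
         B [] (descending (suc t) L ʳ++ []) M<B []
... | st , o , M<st , M<o , readsB =
  o ʳ++ st , as ∷ʳ top , ʳ++⁺ M<o M<st ,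
  subst (λ u → All (u <_) (as ∷ʳ top)) (sym (+-suc L t)) (∷ʳ⁺ (All.map (<-trans (n<1+n _)) <as) (n<1+n _)) ,
  trans (length-∷ʳ as top) (cong suc |as|) ,
  (begin
    run ((descending t (2 + L) ++ B) ++ weave t as) [] []
      ≡⟨ reads-++ {descending t (2 + L)} {B} {[] , []} (reads-descending-from-empty L t) readsB (weave t as) ⟩
    run (weave t as) (st ++ suc t ∷ top ∷ []) (o ++ E ʳ++ [])
      ≡⟨ cong (λ stk → run (weave t as) stk (o ++ E ʳ++ [])) (++-assoc st [ suc t ] [ top ]) ⟨
    run (weave t as) ((st ++ [ suc t ]) ++ [ top ]) (o ++ E ʳ++ [])
      ≡⟨ drain t (st ++ [ suc t ]) top as (o ++ E ʳ++ [])
           (∷ʳ⁺ (All.map (<-trans t<M) M<st) (n<1+n t)) (s≤s (m≤n+m t (suc L)))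
           (All.map (≤-<-trans (m≤n+m t (2 + L))) <as) |as| ⟩
    (o ++ E ʳ++ []) ʳ++ ((st ++ [ suc t ]) ++ Z)
      ≡⟨ ++-ʳ++ o ⟩
    (E ʳ++ []) ʳ++ (o ʳ++ ((st ++ [ suc t ]) ++ Z))
      ≡⟨ ʳ++-ʳ++ E ⟩
    E ++ o ʳ++ ((st ++ [ suc t ]) ++ Z)
      ≡⟨ cong (λ l → E ++ o ʳ++ l) (++-assoc st [ suc t ] Z) ⟩
    E ++ o ʳ++ (st ++ suc t ∷ Z)
      ≡⟨ cong (E ++_) (ʳ++-++ o) ⟨
    E ++ (o ʳ++ st) ++ suc t ∷ Z
      ≡⟨ ++-assoc E (o ʳ++ st) (suc t ∷ Z) ⟨
    (E ++ o ʳ++ st) ++ weave (suc t) (as ∷ʳ top)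
      ∎)
  where
  open ≡-Reasoning
  top = suc (suc L + t)
  E = descending (suc t) L
  Z = zig t (as ∷ʳ top)

[1+j]+[1+j]+L≡j+j+[2+L] : ∀ j L → suc j + suc j + L ≡ j + j + (2 + L)
[1+j]+[1+j]+L≡j+j+[2+L] = solve-∀

descent-phase : ∀ {M} j {t L σ} → j + t ≤ M → DescentShape M t (j + j + L) σ →
  DescentShape M (j + t) L (iterate j s123-132 σ)
descent-phase zero _ shape = shape
descent-phase {M} (suc j) {t} {L} {σ} j+t<M shape =
  descent-step j+t<M
    (descent-phase j (<⇒≤ j+t<M) (subst (λ c → DescentShape M t c σ) ([1+j]+[1+j]+L≡j+j+[2+L] j L) shape))

marked-after-descent : ∀ {M j σ} → j < M → DescentShape M j 1 σ → Marked j (iterate (suc j) s123-132 σ)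
marked-after-descent {M} {j} j<M (B , as , M<B , j<as , |as| , refl)
  with rotate {suc j} j (suc j) B as (n≤1+n j) (All.map (≤-<-trans j<M) M<B) (n<1+n j)
         (All.map (<-trans (n<1+n j)) j<as) |as|
... | β , j<β , eq =
  subst (Marked j)
    (trans (cong₂ (λ k x → iterate k s123-132 x) |as| (sym eq)) (iterate-suc′ j s123-132 _))
    (marker-reaches-front j as [] β j<β j<as [] (trans (length-∷ʳ as (suc j)) (cong suc |as|)))

descending-then-large-not-periodic : ∀ j B → All (suc (j + j) <_) B → 2 ≤ length B →
  ¬ Periodic (iterate (suc (j + j)) s123-132 (descending 0 (suc (j + j)) ++ B))
descending-then-large-not-periodic j B M<B 2≤|B| =
  marked-not-periodic (subst (Marked j) (iterate-+ (suc j) j s123-132 π) marked) long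
  where
  M = suc (j + j)
  π = descending 0 M ++ B
  j<M : j < M
  j<M = s≤s (m≤m+n j j)
  start : DescentShape M 0 (j + j + 1) π
  start = subst (λ L → DescentShape M 0 L π) (sym (+-comm (j + j) 1))
            (B , [] , M<B , [] , refl , sym (++-identityʳ π))
  marked : Marked j (iterate (suc j) s123-132 (iterate j s123-132 π))
  marked = marked-after-descent j<M
    (subst (λ t → DescentShape M t 1 (iterate j s123-132 π)) (+-identityʳ j)
      (descent-phase j (≤-trans (≤-reflexive (+-identityʳ j)) (<⇒≤ j<M)) start))
  long : suc M < length (iterate M s123-132 π)
  long = subst (suc M <_) (sym (trans (length-iterate-s123-132 M π)
                                 (trans (length-++ (descending 0 M)) (cong (_+ length B) (length-descending 0 M)))))
           (subst (_≤ M + length B) (+-comm M 2) (+-monoʳ-≤ M 2≤|B|))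

descending-then-large-↭ : ∀ m c → descending 0 c ++ descending c m ↭ map suc (upTo (m + c))
descending-then-large-↭ m c =
  ↭-trans (++-comm (descending 0 c) (descending c m))
    (↭-trans (↭-reflexive (sym split)) (descending-↭ (m + c)))
  where
  split : descending 0 (m + c) ≡ descending c m ++ descending 0 c
  split = subst (λ u → descending 0 (m + c) ≡ descending u m ++ descending 0 c) (+-identityʳ c)
            (descending-+ 0 m c)

2*[1+j]≡2+j+j : ∀ j → 2 * suc j ≡ 2 + (j + j)
2*[1+j]≡2+j+j = solve-∀

ord-lower-bound : ∀ h n k → 2 * h < n → AllPeriodicAfter n k → 2 * h ≤ k
ord-lower-bound zero    n k _    _           = z≤n
ord-lower-bound (suc j) n k 2h<n allPeriodic = ≮⇒≥ λ k<2h →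
  descending-then-large-not-periodic j B (descending-above M m)
    (≤-trans 2≤m (≤-reflexive (sym (length-descending M m))))
    (periodic-later π (<⇒≤pred (subst (k <_) (2*[1+j]≡2+j+j j) k<2h))
      (allPeriodic π (subst (λ n′ → π ↭ map suc (upTo n′)) (m∸n+n≡m M≤n)
                              (descending-then-large-↭ m M))))
  where
  M = suc (j + j)
  m = n ∸ M
  B = descending M m
  π = descending 0 M ++ B
  2+M≤n : 2 + M ≤ n
  2+M≤n = subst (_< n) (2*[1+j]≡2+j+j j) 2h<n
  M≤n : M ≤ n
  M≤n = m+n≤o⇒n≤o 2 2+M≤n
  2≤m : 2 ≤ m
  2≤m = m+n≤o⇒m≤o∸n 2 2+M≤n

lemma3p13 : ∀ (n : ℕ) → 1 ≤ n →
    ∀ (k : ℕ) → AllPeriodicAfter n k → 2 * ((n ∸ 1) / 2) ≤ k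
lemma3p13 n 1≤n k = ord-lower-bound ((n ∸ 1) / 2) n k 2h<n
  where
  2h<n : 2 * ((n ∸ 1) / 2) < n
  2h<n = begin-strict
    2 * ((n ∸ 1) / 2) ≡⟨ *-comm 2 ((n ∸ 1) / 2) ⟩
    (n ∸ 1) / 2 * 2   ≤⟨ m/n*n≤m (n ∸ 1) 2 ⟩
    n ∸ 1             <⟨ ∸-monoʳ-< (s≤s z≤n) 1≤n ⟩
    n ∸ 0             ≡⟨⟩
    n                 ∎
    where open ≤-Reasoning
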